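{- Let $a\ge2$ and $b\ge2$ be integers, and define $(h_{a,b}(n))_{n\in\mathbb{N}}$ by $h_{a,b}(n)=a$ for integers $n\le0$, $h_{a,b}(1)=b$, and $h_{a,b}(n)=h_{a,b}(n-h_{a,b}(n-1))+h_{a,b}(n-2)$ for $n>1$. Then for all $n\in\mathbb{N}$, $$h_{a,b}(2n)=(n+1)a,\qquad h_{a,b}(2n+1)=na+b.$$ -}

module Defs where

open import Data.Integer using (ℤ; +_; _+_; _-_; _*_; _≤_; _>_)
open import Relation.Binary.PropositionalEquality using (_≡_)
open import Data.Product using (_×_)

IsHofstadterAB : (a b : ℤ) → (ℤ → ℤ) → Set
IsHofstadterAB a b h =
  ((n : ℤ) → n ≤ + 0 → h n ≡ a)
  × (h (+ 1) ≡ b)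
  × ((n : ℤ) → n > + 1 → h n ≡ h (n - h (n - + 1)) + h (n - + 2))

{-# OPTIONS --safe #-}
module Submission where

-- Since a, b ≥ 2, h(m - 1) ≥ m along the induction, so the term h(m - h(m - 1)) of the
-- recurrence looks back to a nonpositive index and equals a: each step is h(m) = a + h(m - 2).

open import Defs
open import Data.Nat using (ℕ; suc; z≤n; s≤s)
import Data.Nat as ℕ
import Data.Nat.Properties as ℕ
open import Data.Nat.Tactic.RingSolver using (solve)
open import Data.List using ([]; _∷_)
open import Data.Integer using (ℤ; +_; _+_; _-_; _*_; _≤_; +≤+; +<+)
open import Data.Integer.Properties
open import Data.Product using (_×_; _,_; proj₁; proj₂)
open import Relation.Binary.PropositionalEquality

2*k≤k*a : ∀ {a} → + 2 ≤ a → ∀ k → + (2 ℕ.* k) ≤ + k * a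
2*k≤k*a {a} a≥2 k = begin
  + (2 ℕ.* k)  ≡⟨ cong +_ (ℕ.*-comm 2 k) ⟩
  + (k ℕ.* 2)  ≡⟨ pos-* k 2 ⟩
  + k * + 2    ≤⟨ *-monoˡ-≤-nonNeg (+ k) a≥2 ⟩
  + k * a      ∎
  where open ≤-Reasoning

2+2*k≤k*a+b : ∀ {a b} → + 2 ≤ a → + 2 ≤ b → ∀ k → + (2 ℕ.+ 2 ℕ.* k) ≤ + k * a + b
2+2*k≤k*a+b {a} {b} a≥2 b≥2 k = begin
  + 2 + + (2 ℕ.* k)  ≤⟨ +-mono-≤ b≥2 (2*k≤k*a a≥2 k) ⟩
  b + + k * a        ≡⟨ +-comm b _ ⟩
  + k * a + b        ∎
  where open ≤-Reasoning

3+2*k≤[k+2]*a : ∀ {a} → + 2 ≤ a → ∀ k → + (3 ℕ.+ 2 ℕ.* k) ≤ + (suc k ℕ.+ 1) * a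
3+2*k≤[k+2]*a {a} a≥2 k = begin
  + (3 ℕ.+ 2 ℕ.* k)        ≤⟨ +≤+ (ℕ.n≤1+n _) ⟩
  + (4 ℕ.+ 2 ℕ.* k)        ≡⟨ cong +_ (solve (k ∷ [])) ⟩
  + (2 ℕ.* (suc k ℕ.+ 1))  ≤⟨ 2*k≤k*a a≥2 (suc k ℕ.+ 1) ⟩
  + (suc k ℕ.+ 1) * a      ∎
  where open ≤-Reasoning

module HofstadterAB {a b : ℤ} {h : ℤ → ℤ} (H : IsHofstadterAB a b h) where
  open ≡-Reasoning

  2+m≤h[1+m]⇒h[2+m]≡a+h[m] : ∀ m → + (2 ℕ.+ m) ≤ h (+ suc m) → h (+ (2 ℕ.+ m)) ≡ a + h (+ m)
  2+m≤h[1+m]⇒h[2+m]≡a+h[m] m lookback = begin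
    h (+ (2 ℕ.+ m))                          ≡⟨ proj₂ (proj₂ H) _ (+<+ (s≤s (s≤s z≤n))) ⟩
    h (+ (2 ℕ.+ m) - h (+ suc m)) + h (+ m)  ≡⟨ cong (_+ h (+ m)) (proj₁ H _ (i≤j⇒i-j≤0 lookback)) ⟩
    a + h (+ m)                              ∎

  ClosedForm : ℕ → Set
  ClosedForm n = h (+ (2 ℕ.* n)) ≡ + (n ℕ.+ 1) * a × h (+ suc (2 ℕ.* n)) ≡ + n * a + b

  closed-form-0 : ClosedForm 0
  closed-form-0 = trans (proj₁ H (+ 0) (+≤+ z≤n)) (sym (*-identityˡ a))
                , trans (proj₁ (proj₂ H)) (sym (+-identityˡ b))

  closed-form-suc : + 2 ≤ a → + 2 ≤ b → ∀ n → ClosedForm n → ClosedForm (suc n)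
  closed-form-suc a≥2 b≥2 n (h[2n] , h[1+2n]) rewrite ℕ.*-suc 2 n = h[2+2n] , h[3+2n]
    where
    h[2+2n] : h (+ (2 ℕ.+ 2 ℕ.* n)) ≡ + (suc n ℕ.+ 1) * a
    h[2+2n] = begin
      h (+ (2 ℕ.+ 2 ℕ.* n))  ≡⟨ 2+m≤h[1+m]⇒h[2+m]≡a+h[m] _ (subst (_ ≤_) (sym h[1+2n]) (2+2*k≤k*a+b a≥2 b≥2 n)) ⟩
      a + h (+ (2 ℕ.* n))    ≡⟨ cong (_+_ a) h[2n] ⟩
      a + + (n ℕ.+ 1) * a    ≡⟨ suc-* (+ (n ℕ.+ 1)) a ⟨
      + (suc n ℕ.+ 1) * a    ∎

    h[3+2n] : h (+ (3 ℕ.+ 2 ℕ.* n)) ≡ + suc n * a + b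
    h[3+2n] = begin
      h (+ (3 ℕ.+ 2 ℕ.* n))      ≡⟨ 2+m≤h[1+m]⇒h[2+m]≡a+h[m] _ (subst (_ ≤_) (sym h[2+2n]) (3+2*k≤[k+2]*a a≥2 n)) ⟩
      a + h (+ suc (2 ℕ.* n))    ≡⟨ cong (_+_ a) h[1+2n] ⟩
      a + (+ n * a + b)          ≡⟨ +-assoc a _ b ⟨
      a + + n * a + b            ≡⟨ cong (_+ b) (suc-* (+ n) a) ⟨
      + suc n * a + b            ∎

  closed-form : + 2 ≤ a → + 2 ≤ b → ∀ n → ClosedForm n
  closed-form a≥2 b≥2 0       = closed-form-0
  closed-form a≥2 b≥2 (suc n) = closed-form-suc a≥2 b≥2 n (closed-form a≥2 b≥2 n)

theorem5p1 : (a b : ℤ) → + 2 ≤ a → + 2 ≤ b → (h : ℤ → ℤ) → IsHofstadterAB a b h →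
    (n : ℕ) → (h (+ (2 Data.Nat.* n)) ≡ + (n Data.Nat.+ 1) * a)
    × (h (+ (2 Data.Nat.* n Data.Nat.+ 1)) ≡ + n * a + b)
theorem5p1 a b a≥2 b≥2 h H n with HofstadterAB.closed-form H a≥2 b≥2 n
... | h[2n] , h[1+2n] = h[2n] , subst (λ k → h (+ k) ≡ + n * a + b) (ℕ.+-comm 1 (2 ℕ.* n)) h[1+2n]
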